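{- Let $\mathcal{P} = (\mathcal{X}, C)$ denote a program over $(A, \sqsubseteq)$. For any languages $L_1, \ldots, L_k \subseteq C^*$, we have $([\![L_k]\!]^* \circ \cdots \circ [\![L_1]\!]^*)(\bot) \ \sqsubseteq \ \mathrm{MFP}(\mathcal{P})$.
   Context: $(A, \sqsubseteq)$ is a complete lattice with least element $\bot$; lattices of functions into $A$ are ordered pointwise. For a monotonic $f \in A \rightarrow A$, $f^*(x)$ denotes the greatest lower bound of $\{a \in A \mid (x \sqcup f(a)) \sqsubseteq a\}$, i.e. the least post-fix-point of $f$ greater than $x$ (applied likewise to monotonic maps on valuations). A program over $(A,\sqsubseteq)$ is a pair $\mathcal{P} = (\mathcal{X}, C)$ with $\mathcal{X}$ a finite set of variables and $C$ a finite set of commands $\langle X_1, \ldots, X_n ; f ; X \rangle$ (pairwise distinct input variables $X_i \in \mathcal{X}$, monotonic $f \in A^n \rightarrow A$, output variable $X \in \mathcal{X}$). A valuation is a function $\rho \in \mathcal{X} \rightarrow A$. The semantics $[\![c]\!]$ of such a command is the map on valuations with $[\![c]\!](\rho)(X) = f(\rho(X_1), \ldots, \rho(X_n))$ and $[\![c]\!](\rho)(Y) = \rho(Y)$ for $Y \neq X$. Traces are words over $C$; $[\![\varepsilon]\!]$ is the identity and $[\![c \cdot \sigma]\!] = [\![\sigma]\!] \circ [\![c]\!]$; for $L \subseteq C^*$, $[\![L]\!] = \bigsqcup_{\sigma \in L} [\![\sigma]\!]$ (pointwise least upper bound). The MFP-solution $\mathrm{MFP}(\mathcal{P})$ is the greatest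 lower bound of all valuations $\rho$ with $[\![c]\!](\rho) \sqsubseteq \rho$ for all $c \in C$; it equals $[\![C]\!]^*(\bot)$. -}

module Defs where

open import Level using (Level; suc; Lift; lift)
open import Data.Bool using (Bool; true; false)
open import Data.Empty.Polymorphic using (⊥)
open import Data.Nat using (ℕ)
open import Data.Fin using (Fin; _≟_)
open import Data.List using (List; []; _∷_)
open import Data.Product using (Σ; _×_; _,_; proj₁)
open import Relation.Binary.PropositionalEquality using (_≡_)
open import Relation.Binary.Structures using (IsPartialOrder)
open import Relation.Nullary using (yes; no)
open import Function.Definitions using (Injective)

record CompleteLattice (ℓ : Level) : Set (suc ℓ) where
  field
    Carrier        : Set ℓ
    _⊑_            : Carrier → Carrier → Set ℓ
    isPartialOrder : IsPartialOrder _≡_ _⊑_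
    ⨅              : (Carrier → Set ℓ) → Carrier
    ⨅-lower        : (S : Carrier → Set ℓ) (a : Carrier) → S a → ⨅ S ⊑ a
    ⨅-greatest     : (S : Carrier → Set ℓ) (b : Carrier) →
                     ((a : Carrier) → S a → b ⊑ a) → b ⊑ ⨅ S
    ⨆              : {I : Set ℓ} → (I → Carrier) → Carrier
    ⨆-upper        : {I : Set ℓ} (g : I → Carrier) (i : I) → g i ⊑ ⨆ g
    ⨆-least        : {I : Set ℓ} (g : I → Carrier) (b : Carrier) →
                     ((i : I) → g i ⊑ b) → ⨆ g ⊑ b

  ⊥A : Carrier
  ⊥A = ⨆ {I = ⊥} (λ ())

  _⊔_ : Carrier → Carrier → Carrier
  x ⊔ y = ⨆ {I = Lift ℓ Bool} (λ { (lift true) → x ; (lift false) → y })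

module Program {ℓ : Level} (𝔸 : CompleteLattice ℓ) where
  open CompleteLattice 𝔸

  _⊑ᵗ_ : {n : ℕ} → (Fin n → Carrier) → (Fin n → Carrier) → Set ℓ
  u ⊑ᵗ v = ∀ i → u i ⊑ v i

  -- A command ⟨X₁,…,Xₙ ; f ; X⟩ over the variables Fin m
  record Command (m : ℕ) : Set ℓ where
    field
      arity     : ℕ
      inputs    : Fin arity → Fin m
      distinct  : Injective _≡_ _≡_ inputs
      fun       : (Fin arity → Carrier) → Carrier
      monotone  : ∀ {u v} → u ⊑ᵗ v → fun u ⊑ fun v
      output    : Fin m

  -- A program (𝒳, C): 𝒳 = Fin m (finite set of variables),
  -- C = the finite set of commands, enumerated as cmd : Fin k → Command m.
  record Prog : Set ℓ where
    field
      m   : ℕ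
      k   : ℕ
      cmd : Fin k → Command m

  module _ (P : Prog) where
    open Prog P

    CmdName : Set
    CmdName = Fin k

    Valuation : Set ℓ
    Valuation = Fin m → Carrier

    _⊑ᵛ_ : Valuation → Valuation → Set ℓ
    ρ ⊑ᵛ ρ' = ∀ Y → ρ Y ⊑ ρ' Y

    ⊥ᵛ : Valuation
    ⊥ᵛ _ = ⊥A

    _⊔ᵛ_ : Valuation → Valuation → Valuation
    (ρ ⊔ᵛ ρ') Y = ρ Y ⊔ ρ' Y

    ⨅ᵛ : (Valuation → Set ℓ) → Valuation
    ⨅ᵛ S Y = ⨅ (λ a → Σ Valuation (λ ρ → S ρ × ρ Y ≡ a))

    _* : (Valuation → Valuation) → Valuation → Valuation
    (F *) x = ⨅ᵛ (λ a → (x ⊔ᵛ F a) ⊑ᵛ a)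

    ⟦_⟧c : CmdName → Valuation → Valuation
    ⟦ c ⟧c ρ Y with Y ≟ Command.output (cmd c)
    ... | yes _ = Command.fun (cmd c) (λ i → ρ (Command.inputs (cmd c) i))
    ... | no  _ = ρ Y

    Trace : Set
    Trace = List CmdName

    ⟦_⟧t : Trace → Valuation → Valuation
    ⟦ [] ⟧t ρ = ρ
    ⟦ c ∷ σ ⟧t ρ = ⟦ σ ⟧t (⟦ c ⟧c ρ)

    Language : Set (suc ℓ)
    Language = Trace → Set ℓ

    ⟦_⟧L : Language → Valuation → Valuation
    ⟦ L ⟧L ρ Y = ⨆ {I = Σ Trace L} (λ σ → ⟦ proj₁ σ ⟧t ρ Y)

    MFP : Valuation
    MFP = ⨅ᵛ (λ ρ → (c : CmdName) → ⟦ c ⟧c ρ ⊑ᵛ ρ)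

    iterStar : List Language → Valuation → Valuation
    iterStar [] ρ = ρ
    iterStar (L ∷ Ls) ρ = iterStar Ls ((⟦ L ⟧L *) ρ)

module Submission where

-- MFP(𝒫) is a post-fix-point of every command: it is the
-- meet of all valuations ρ with ⟦c⟧ρ ⊑ ρ for every c, and since ⟦c⟧ is
-- monotone, ⟦c⟧ maps this meet below each such ρ.  By monotonicity and
-- induction on traces it is then a post-fix-point of every ⟦σ⟧, and hence
-- of every ⟦L⟧ = ⨆_{σ ∈ L} ⟦σ⟧.  Now F*(x) is the meet of the
-- post-fix-points of F lying above x, so F*(x) ⊑ ρ whenever ρ is a
-- post-fix-point of F with x ⊑ ρ.  Starting from ⊥ ⊑ MFP and applying
-- this with F = ⟦L₁⟧, …, ⟦L_k⟧ in turn keeps every intermediate value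
-- below MFP, which is the theorem.

open import Defs
open import Level using (Level; lift)
open import Data.Bool using (true; false)
open import Data.List using (List; []; _∷_)
open import Data.Fin using (_≟_)
open import Data.Product using (_,_; proj₁)
open import Relation.Binary.PropositionalEquality using (refl; subst)
open import Relation.Nullary using (yes; no)
open import Relation.Binary.Structures using (IsPartialOrder; IsPreorder)

module Proof {ℓ : Level} (𝔸 : CompleteLattice ℓ) (P : Program.Prog 𝔸) where
  open CompleteLattice 𝔸
  open Program 𝔸
  open Prog P

  private
    Val : Set ℓ
    Val = Valuation P

    _≤_ : Val → Val → Set ℓ
    _≤_ = _⊑ᵛ_ P

  ⊑-refl : ∀ {a} → a ⊑ a
  ⊑-refl = IsPreorder.reflexive (IsPartialOrder.isPreorder isPartialOrder) refl

  ⊑-trans : ∀ {a b c} → a ⊑ b → b ⊑ c → a ⊑ c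
  ⊑-trans = IsPreorder.trans (IsPartialOrder.isPreorder isPartialOrder)

  ≤-trans : ∀ {ρ ρ' ρ''} → ρ ≤ ρ' → ρ' ≤ ρ'' → ρ ≤ ρ''
  ≤-trans h h' Y = ⊑-trans (h Y) (h' Y)

  ⊥ᵛ-least : ∀ ρ → ⊥ᵛ P ≤ ρ
  ⊥ᵛ-least ρ Y = ⨆-least _ _ λ ()

  ⨅ᵛ-lower : ∀ (S : Val → Set ℓ) ρ → S ρ → ⨅ᵛ P S ≤ ρ
  ⨅ᵛ-lower S ρ Sρ Y = ⨅-lower _ (ρ Y) (ρ , Sρ , refl)

  ⨅ᵛ-greatest : ∀ (S : Val → Set ℓ) ρ₀ → (∀ ρ → S ρ → ρ₀ ≤ ρ) → ρ₀ ≤ ⨅ᵛ P S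
  ⨅ᵛ-greatest S ρ₀ below Y = ⨅-greatest _ _ λ { a (ρ , Sρ , eq) →
    subst (ρ₀ Y ⊑_) eq (below ρ Sρ Y) }

  *-least : ∀ F x ρ → x ≤ ρ → F ρ ≤ ρ → (_* P F) x ≤ ρ
  *-least F x ρ x≤ρ Fρ≤ρ = ⨅ᵛ-lower _ ρ join≤ρ
    where
    join≤ρ : _⊔ᵛ_ P x (F ρ) ≤ ρ
    join≤ρ Y = ⨆-least _ _ λ { (lift true) → x≤ρ Y ; (lift false) → Fρ≤ρ Y }

  ⟦⟧c-mono : ∀ c {ρ ρ'} → ρ ≤ ρ' → ⟦_⟧c P c ρ ≤ ⟦_⟧c P c ρ'
  ⟦⟧c-mono c h Y with Y ≟ Command.output (cmd c)
  ... | yes _ = Command.monotone (cmd c) (λ i → h (Command.inputs (cmd c) i))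
  ... | no  _ = h Y

  ⟦⟧t-mono : ∀ σ {ρ ρ'} → ρ ≤ ρ' → ⟦_⟧t P σ ρ ≤ ⟦_⟧t P σ ρ'
  ⟦⟧t-mono []      h = h
  ⟦⟧t-mono (c ∷ σ) h = ⟦⟧t-mono σ (⟦⟧c-mono c h)

  trace-postfix : ∀ ρ → (∀ c → ⟦_⟧c P c ρ ≤ ρ) → ∀ σ → ⟦_⟧t P σ ρ ≤ ρ
  trace-postfix ρ post []      Y = ⊑-refl
  trace-postfix ρ post (c ∷ σ)   = ≤-trans (⟦⟧t-mono σ (post c)) (trace-postfix ρ post σ)

  language-postfix : ∀ ρ → (∀ c → ⟦_⟧c P c ρ ≤ ρ) → ∀ L → ⟦_⟧L P L ρ ≤ ρ
  language-postfix ρ post L Y = ⨆-least _ _ λ σ → trace-postfix ρ post (proj₁ σ) Y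

  -- MFP(𝒫) is itself a post-fix-point of every command: ⟦c⟧ MFP lies
  -- below every ρ in the defining set, since MFP ≤ ρ and ⟦c⟧ is monotone.
  MFP-postfix : ∀ c → ⟦_⟧c P c (MFP P) ≤ MFP P
  MFP-postfix c = ⨅ᵛ-greatest _ _ λ ρ post →
    ≤-trans (⟦⟧c-mono c (⨅ᵛ-lower _ ρ post)) (post c)

  iterStar-below-MFP : ∀ Ls ρ → ρ ≤ MFP P → iterStar P Ls ρ ≤ MFP P
  iterStar-below-MFP []       ρ ρ≤MFP = ρ≤MFP
  iterStar-below-MFP (L ∷ Ls) ρ ρ≤MFP = iterStar-below-MFP Ls _
    (*-least (⟦_⟧L P L) ρ (MFP P) ρ≤MFP (language-postfix (MFP P) MFP-postfix L))

mainTheorem1 : {ℓ : Level} (𝔸 : CompleteLattice ℓ) (P : Program.Prog 𝔸)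
    (Ls : List (Program.Language 𝔸 P)) →
    Program._⊑ᵛ_ 𝔸 P (Program.iterStar 𝔸 P Ls (Program.⊥ᵛ 𝔸 P)) (Program.MFP 𝔸 P)
mainTheorem1 𝔸 P Ls =
  Proof.iterStar-below-MFP 𝔸 P Ls _ (Proof.⊥ᵛ-least 𝔸 P (Program.MFP 𝔸 P))
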